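{- Let $v_1,\dots,v_r$ ($r\ge 2$) be arbitrary (possibly empty) words over the alphabet $\{1,0,\bar 1\}$. Then \[ [v_1\,0\,v_2\,0\,\cdots\,0\,v_r]=[v_1 0]\,[0 v_2 0]\cdots[0 v_{r-1}0]\,[0 v_r]. \]
   Context: Let $a,b,c,d,e$ be indeterminates. Words are finite words (including the empty word) over the alphabet $\{1,0,\bar1\}$, where $\bar 1$ stands for $-1$. To each word $u$ one associates a Laurent polynomial $[u]$ in $a,b,c,d,e$, defined by the rules: for all words $v,w$ (possibly empty), $[v01w]=[v0w]/a$; $[v\bar1 1w]=([v\bar1w]+[v1w])/b$; $[v\bar10w]=[v0w]/c$; $[v\bar1]=[v]/d$; $[1v]=[v]/e$; and $[0^s]=1$ for every $s\ge0$ (in particular for the empty word). These rules determine $[u]$ uniquely and consistently: any way of applying them reduces $[u]$ to the same Laurent polynomial. -}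

module Defs where

open import Data.Nat using (ℕ; zero; suc)
open import Data.Bool using (Bool; true; false; _∧_)
open import Data.List using (List; []; _∷_; _++_; length; map; foldr; concat)
open import Data.Maybe using (Maybe; just; nothing)
open import Algebra.Bundles using (CommutativeRing)

data Letter : Set where
  one  : Letter
  nil  : Letter   -- 0
  mone : Letter   -- 1̄ = -1

Word : Set
Word = List Letter

allZero : Word → Bool
allZero []         = true
allZero (nil ∷ w)  = allZero w
allZero (one ∷ w)  = false
allZero (mone ∷ w) = false

endsMone : Word → Maybe Word
endsMone []            = nothing
endsMone (mone ∷ [])   = just []
endsMone (x ∷ [])      = nothing
endsMone (x ∷ y ∷ w) with endsMone (y ∷ w)
... | just v  = just (x ∷ v)
... | nothing = nothing

-- One application of the rules for the factors 01, 1̄1, 1̄0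
-- (at the leftmost position where one of these factors occurs).
data Step : Set where
  ruleA : Word → Step          -- v01w ↦ v0w        (factor 1/a)
  ruleB : Word → Word → Step   -- v1̄1w ↦ v1̄w , v1w  (factor 1/b)
  ruleC : Word → Step          -- v1̄0w ↦ v0w        (factor 1/c)

consStep : Letter → Step → Step
consStep x (ruleA u)   = ruleA (x ∷ u)
consStep x (ruleB u v) = ruleB (x ∷ u) (x ∷ v)
consStep x (ruleC u)   = ruleC (x ∷ u)

findStep : Word → Maybe Step
findStep (nil ∷ one ∷ w)   = just (ruleA (nil ∷ w))
findStep (mone ∷ one ∷ w)  = just (ruleB (mone ∷ w) (one ∷ w))
findStep (mone ∷ nil ∷ w)  = just (ruleC (nil ∷ w))
findStep []                = nothing
findStep (x ∷ w) with findStep w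
... | just s  = just (consStep x s)
... | nothing = nothing

-- The bracket [u], evaluated in an arbitrary commutative ring R, where
-- ia, ib, ic, id, ie are the values of 1/a, 1/b, 1/c, 1/d, 1/e.
-- Every rule multiplies by one of 1/a,...,1/e, so [u] is a polynomial in
-- a⁻¹,...,e⁻¹ with integer coefficients.
module Bracket {c ℓ} (R : CommutativeRing c ℓ)
                (ia ib ic id ie : CommutativeRing.Carrier R) where
  open CommutativeRing R

  -- fuel-bounded evaluation; fuel = length u suffices since every rule
  -- shortens the word by one letter.
  br : ℕ → Word → Carrier
  br zero    u = 1#
  br (suc n) u with allZero u
  ... | true = 1#
  br (suc n) (one ∷ v) | false = ie * br n v
  br (suc n) u         | false with endsMone u
  ... | just v  = id * br n v
  ... | nothing with findStep u
  ...   | just (ruleA w)   = ia * br n w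
  ...   | just (ruleB w w') = ib * (br n w + br n w')
  ...   | just (ruleC w)   = ic * br n w
  ...   | nothing          = 1#                          -- unreachable

  ⟦_⟧ : Word → Carrier
  ⟦ u ⟧ = br (length u) u

  product : List Carrier → Carrier
  product = foldr _*_ 1#

-- v₁ 0 m₁ 0 m₂ 0 ⋯ 0 mₖ 0 vᵣ  (with r = k + 2)
joinWords : Word → List Word → Word → Word
joinWords v₁ ms vᵣ = v₁ ++ (nil ∷ concat (map (λ m → m ++ (nil ∷ [])) ms)) ++ vᵣ

-- Every rule deletes one letter 1 or 1̄ and never a 0, and the only redexes that
-- contain a 0 are 01 and 1̄0.  So in u 0 w each rule the bracket applies acts either
-- on u 0 alone (a leading 1, or the leftmost redex if it begins in u) or on 0 w alone
-- (a trailing 1̄, or a redex beginning at or after the 0), while the 0 survives.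
-- Induction on the length gives [u 0 w] = [u 0] [0 w], and cutting at each
-- separating 0 in turn gives the product formula.

module Submission where

open import Defs
open import Data.List using (List; []; _∷_; _++_; map; length; concat)
open import Data.List.Properties using (++-assoc)
open import Data.List.Relation.Unary.All using (All; []; _∷_)
import Data.List.Relation.Unary.All as All
open import Data.Maybe using (Maybe; just; nothing; _<∣>_; maybe′)
import Data.Maybe as Maybe
import Data.Maybe.Properties as Maybeₚ
import Data.Maybe.Relation.Unary.All as MaybeAll
open import Data.Nat using (zero; suc)
open import Data.Nat.Properties using (suc-injective)
open import Data.Bool using (true; false; if_then_else_)
open import Data.Bool.Properties using (if-eta)
open import Function using (_∘_)
open import Algebra.Bundles using (CommutativeRing)
import Algebra.Properties.CommutativeSemigroup as CommutativeSemigroupProperties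
open import Relation.Nullary using (¬_)
open import Relation.Binary.PropositionalEquality
  using (_≡_; refl; sym; trans; cong; cong₂; subst; module ≡-Reasoning)
import Relation.Binary.Reasoning.Setoid as SetoidReasoning

infix 4 _≺_
data _≺_ : Word → Word → Set where
  drop-one  : ∀ {u} → u ≺ one ∷ u
  drop-mone : ∀ {u} → u ≺ mone ∷ u
  keep      : ∀ {p u} x → p ≺ u → x ∷ p ≺ x ∷ u

≺-length : ∀ {p u} → p ≺ u → suc (length p) ≡ length u
≺-length drop-one   = refl
≺-length drop-mone  = refl
≺-length (keep x d) = cong suc (≺-length d)

≺-allZero : ∀ {p u} → p ≺ u → allZero u ≡ false
≺-allZero drop-one     = refl
≺-allZero drop-mone    = refl
≺-allZero (keep one d)  = refl
≺-allZero (keep nil d)  = ≺-allZero d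
≺-allZero (keep mone d) = refl

≺-++ˡ : ∀ a {p u} → p ≺ u → a ++ p ≺ a ++ u
≺-++ˡ []      d = d
≺-++ˡ (x ∷ a) d = keep x (≺-++ˡ a d)

endsMone-∷ : ∀ x y w → endsMone (x ∷ y ∷ w) ≡ Maybe.map (x ∷_) (endsMone (y ∷ w))
endsMone-∷ one y w with endsMone (y ∷ w)
... | just _  = refl
... | nothing = refl
endsMone-∷ nil y w with endsMone (y ∷ w)
... | just _  = refl
... | nothing = refl
endsMone-∷ mone y w with endsMone (y ∷ w)
... | just _  = refl
... | nothing = refl

endsMone-deletes : ∀ u {v} → endsMone u ≡ just v → v ≺ u
endsMone-deletes (mone ∷ []) refl = drop-mone
endsMone-deletes (x ∷ y ∷ w) eq rewrite endsMone-∷ x y w with endsMone (y ∷ w) in eq′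
... | just v′ with refl ← eq = keep x (endsMone-deletes (y ∷ w) eq′)

endsMone-++-nil∷ : ∀ a w →
  endsMone (a ++ nil ∷ w) ≡ Maybe.map (λ v → a ++ nil ∷ v) (endsMone w)
endsMone-++-nil∷ []      []      = refl
endsMone-++-nil∷ []      (y ∷ w) = endsMone-∷ nil y w
endsMone-++-nil∷ (x ∷ a) w       = begin
  endsMone (x ∷ a ++ nil ∷ w)
    ≡⟨ endsMone-∷-++ a ⟩
  Maybe.map (x ∷_) (endsMone (a ++ nil ∷ w))
    ≡⟨ cong (Maybe.map (x ∷_)) (endsMone-++-nil∷ a w) ⟩
  Maybe.map (x ∷_) (Maybe.map (λ v → a ++ nil ∷ v) (endsMone w))
    ≡⟨ Maybeₚ.map-∘ (endsMone w) ⟨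
  Maybe.map (λ v → x ∷ a ++ nil ∷ v) (endsMone w)
    ∎
  where
  open ≡-Reasoning
  endsMone-∷-++ : ∀ a →
    endsMone (x ∷ a ++ nil ∷ w) ≡ Maybe.map (x ∷_) (endsMone (a ++ nil ∷ w))
  endsMone-∷-++ []      = endsMone-∷ x nil w
  endsMone-∷-++ (y ∷ a) = endsMone-∷ x y (a ++ nil ∷ w)

stepWords : Step → List Word
stepWords (ruleA w)    = w ∷ []
stepWords (ruleB w w′) = w ∷ w′ ∷ []
stepWords (ruleC w)    = w ∷ []

mapStep : (Word → Word) → Step → Step
mapStep f (ruleA w)    = ruleA (f w)
mapStep f (ruleB w w′) = ruleB (f w) (f w′)
mapStep f (ruleC w)    = ruleC (f w)

redex : Letter → Word → Maybe Step
redex nil  (one ∷ t) = just (ruleA (nil ∷ t))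
redex mone (one ∷ t) = just (ruleB (mone ∷ t) (one ∷ t))
redex mone (nil ∷ t) = just (ruleC (nil ∷ t))
redex _    _         = nothing

findStep-∷ : ∀ x t → findStep (x ∷ t) ≡ redex x t <∣> Maybe.map (consStep x) (findStep t)
findStep-∷ one  []         = refl
findStep-∷ nil  []         = refl
findStep-∷ mone []         = refl
findStep-∷ nil  (one ∷ t)  = refl
findStep-∷ mone (one ∷ t)  = refl
findStep-∷ mone (nil ∷ t)  = refl
findStep-∷ one  (y ∷ t) with findStep (y ∷ t)
... | just _  = refl
... | nothing = refl
findStep-∷ nil  (nil ∷ t) with findStep (nil ∷ t)
... | just _  = refl
... | nothing = refl
findStep-∷ nil  (mone ∷ t) with findStep (mone ∷ t)
... | just _  = refl
... | nothing = refl
findStep-∷ mone (mone ∷ t) with findStep (mone ∷ t)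
... | just _  = refl
... | nothing = refl

StepDeletes : Word → Step → Set
StepDeletes u s = All (_≺ u) (stepWords s)

<∣>-all : ∀ {A : Set} {P : A → Set} {m n : Maybe A} →
          MaybeAll.All P m → MaybeAll.All P n → MaybeAll.All P (m <∣> n)
<∣>-all (MaybeAll.just p) _ = MaybeAll.just p
<∣>-all MaybeAll.nothing  q = q

redex-deletes : ∀ x t → MaybeAll.All (StepDeletes (x ∷ t)) (redex x t)
redex-deletes one  t          = MaybeAll.nothing
redex-deletes nil  []         = MaybeAll.nothing
redex-deletes nil  (one ∷ t)  = MaybeAll.just (keep nil drop-one ∷ [])
redex-deletes nil  (nil ∷ t)  = MaybeAll.nothing
redex-deletes nil  (mone ∷ t) = MaybeAll.nothing
redex-deletes mone []         = MaybeAll.nothing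
redex-deletes mone (one ∷ t)  = MaybeAll.just (keep mone drop-one ∷ drop-mone ∷ [])
redex-deletes mone (nil ∷ t)  = MaybeAll.just (drop-mone ∷ [])
redex-deletes mone (mone ∷ t) = MaybeAll.nothing

consStep-deletes : ∀ x {t} s → StepDeletes t s → StepDeletes (x ∷ t) (consStep x s)
consStep-deletes x (ruleA w)    (d ∷ [])      = keep x d ∷ []
consStep-deletes x (ruleB w w′) (d ∷ d′ ∷ []) = keep x d ∷ keep x d′ ∷ []
consStep-deletes x (ruleC w)    (d ∷ [])      = keep x d ∷ []

findStep-deletes : ∀ u → MaybeAll.All (StepDeletes u) (findStep u)
findStep-deletes []      = MaybeAll.nothing
findStep-deletes (x ∷ t) rewrite findStep-∷ x t =
  <∣>-all (redex-deletes x t) (mapAll (findStep t) (findStep-deletes t))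
  where
  mapAll : ∀ m → MaybeAll.All (StepDeletes t) m →
           MaybeAll.All (StepDeletes (x ∷ t)) (Maybe.map (consStep x) m)
  mapAll (just s) (MaybeAll.just d) = MaybeAll.just (consStep-deletes x s d)
  mapAll nothing  MaybeAll.nothing  = MaybeAll.nothing

findStep-nonzero : ∀ u {s} → findStep u ≡ just s → allZero u ≡ false
findStep-nonzero u f with findStep u | findStep-deletes u
findStep-nonzero u refl | just (ruleA _)   | MaybeAll.just (d ∷ _) = ≺-allZero d
findStep-nonzero u refl | just (ruleB _ _) | MaybeAll.just (d ∷ _) = ≺-allZero d
findStep-nonzero u refl | just (ruleC _)   | MaybeAll.just (d ∷ _) = ≺-allZero d

findStep-deletes′ : ∀ u {s} → findStep u ≡ just s → StepDeletes u s
findStep-deletes′ u f = MaybeAll.drop-just (subst (MaybeAll.All _) f (findStep-deletes u))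

mapStep-deletes : ∀ {u} f s → StepDeletes u (mapStep f s) → All (λ p → f p ≺ u) (stepWords s)
mapStep-deletes f (ruleA _)   (d ∷ [])      = d ∷ []
mapStep-deletes f (ruleB _ _) (d ∷ d′ ∷ []) = d ∷ d′ ∷ []
mapStep-deletes f (ruleC _)   (d ∷ [])      = d ∷ []

-- leftRedex u is the leftmost redex of u ++ nil ∷ w that begins inside u, with the
-- suffix nil ∷ w cut off from its words; it does not depend on w, since the only
-- redex across the boundary is 1̄0 and no rule deletes a 0.
redex₀ : Letter → Word → Maybe Step
redex₀ mone []      = just (ruleC [])
redex₀ _    []      = nothing
redex₀ x    (y ∷ u) = redex x (y ∷ u)

leftRedex : Word → Maybe Step
leftRedex []      = nothing
leftRedex (x ∷ u) = redex₀ x u <∣> Maybe.map (consStep x) (leftRedex u)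

redex-++-nil∷ : ∀ x u w →
  redex x (u ++ nil ∷ w) ≡ Maybe.map (mapStep (_++ nil ∷ w)) (redex₀ x u)
redex-++-nil∷ one  []         w = refl
redex-++-nil∷ one  (y ∷ u)    w = refl
redex-++-nil∷ nil  []         w = refl
redex-++-nil∷ nil  (one ∷ u)  w = refl
redex-++-nil∷ nil  (nil ∷ u)  w = refl
redex-++-nil∷ nil  (mone ∷ u) w = refl
redex-++-nil∷ mone []         w = refl
redex-++-nil∷ mone (one ∷ u)  w = refl
redex-++-nil∷ mone (nil ∷ u)  w = refl
redex-++-nil∷ mone (mone ∷ u) w = refl

findStep-++-nil∷ : ∀ u w →
  findStep (u ++ nil ∷ w) ≡ maybe′ (just ∘ mapStep (_++ nil ∷ w))
                                   (Maybe.map (mapStep (u ++_)) (findStep (nil ∷ w)))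
                                   (leftRedex u)
findStep-++-nil∷ [] w = sym (Maybeₚ.map-id-local (lemma (findStep (nil ∷ w))))
  where
  lemma : ∀ m → MaybeAll.All (λ s → mapStep (λ v → v) s ≡ s) m
  lemma (just (ruleA _))   = MaybeAll.just refl
  lemma (just (ruleB _ _)) = MaybeAll.just refl
  lemma (just (ruleC _))   = MaybeAll.just refl
  lemma nothing            = MaybeAll.nothing
findStep-++-nil∷ (x ∷ u) w
  rewrite findStep-∷ x (u ++ nil ∷ w) | redex-++-nil∷ x u w | findStep-++-nil∷ u w
  with redex₀ x u | leftRedex u
... | just s  | _                = refl
... | nothing | just (ruleA _)   = refl
... | nothing | just (ruleB _ _) = refl
... | nothing | just (ruleC _)   = refl
... | nothing | nothing          =
  sym (trans (Maybeₚ.map-cong commute (findStep (nil ∷ w))) (Maybeₚ.map-∘ (findStep (nil ∷ w))))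
  where
  commute : ∀ s → mapStep ((x ∷ u) ++_) s ≡ consStep x (mapStep (u ++_) s)
  commute (ruleA _)   = refl
  commute (ruleB _ _) = refl
  commute (ruleC _)   = refl

findStep-++-leftRedex : ∀ u w {s} → leftRedex u ≡ just s →
  findStep (u ++ nil ∷ w) ≡ just (mapStep (_++ nil ∷ w) s)
findStep-++-leftRedex u w l = trans (findStep-++-nil∷ u w) (cong (maybe′ _ _) l)

findStep-++-noLeftRedex : ∀ u w {m} → leftRedex u ≡ nothing → findStep (nil ∷ w) ≡ m →
  findStep (u ++ nil ∷ w) ≡ Maybe.map (mapStep (u ++_)) m
findStep-++-noLeftRedex u w l f =
  trans (findStep-++-nil∷ u w) (trans (cong (maybe′ _ _) l) (cong (Maybe.map _) f))

data Rule : Set where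
  halt             : Rule
  dropLeadingOne   : Word → Rule
  dropTrailingMone : Word → Rule
  apply            : Step → Rule

ruleWords : Rule → List Word
ruleWords halt                 = []
ruleWords (dropLeadingOne v)   = v ∷ []
ruleWords (dropTrailingMone v) = v ∷ []
ruleWords (apply s)            = stepWords s

innerRule : Word → Rule
innerRule u = maybe′ dropTrailingMone (maybe′ apply halt (findStep u)) (endsMone u)

firstRule : Word → Rule
firstRule (one ∷ v) = dropLeadingOne v
firstRule u         = innerRule u

rule : Word → Rule
rule u = if allZero u then halt else firstRule u

innerRule-deletes : ∀ u → All (_≺ u) (ruleWords (innerRule u))
innerRule-deletes u with endsMone u in e
... | just v  = endsMone-deletes u e ∷ []
... | nothing with findStep u | findStep-deletes u
...   | just s  | MaybeAll.just d = d
...   | nothing | _               = []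

rule-deletes : ∀ u → All (_≺ u) (ruleWords (rule u))
rule-deletes u with allZero u
... | true = []
rule-deletes []         | false = []
rule-deletes (one ∷ v)  | false = drop-one ∷ []
rule-deletes (nil ∷ v)  | false = innerRule-deletes (nil ∷ v)
rule-deletes (mone ∷ v) | false = innerRule-deletes (mone ∷ v)

nil≢one : ¬ nil ≡ one
nil≢one ()

rule-∷ : ∀ {x} → ¬ x ≡ one → ∀ z →
         rule (x ∷ z) ≡ (if allZero (x ∷ z) then halt else innerRule (x ∷ z))
rule-∷ {one}  x≢one z with () ← x≢one refl
rule-∷ {nil}  _     z = refl
rule-∷ {mone} _     z = refl

module Evaluation {c ℓ} (R : CommutativeRing c ℓ)
                  (ia ib ic id ie : CommutativeRing.Carrier R) where
  open CommutativeRing R hiding (refl) renaming (sym to ≈-sym; trans to ≈-trans)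
  open Bracket R ia ib ic id ie
  open CommutativeSemigroupProperties *-commutativeSemigroup using (x∙yz≈y∙xz)
  open SetoidReasoning setoid

  evalStep : (Word → Carrier) → Step → Carrier
  evalStep f (ruleA w)    = ia * f w
  evalStep f (ruleB w w′) = ib * (f w + f w′)
  evalStep f (ruleC w)    = ic * f w

  evalRule : (Word → Carrier) → Rule → Carrier
  evalRule f halt                 = 1#
  evalRule f (dropLeadingOne v)   = ie * f v
  evalRule f (dropTrailingMone v) = id * f v
  evalRule f (apply s)            = evalStep f s

  br-suc : ∀ n u → br (suc n) u ≡ evalRule (br n) (rule u)
  br-suc n u with allZero u
  ... | true = refl
  br-suc n []         | false = refl
  br-suc n (one ∷ v)  | false = refl
  br-suc n (nil ∷ v)  | false with endsMone (nil ∷ v)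
  ... | just _  = refl
  ... | nothing with findStep (nil ∷ v)
  ...   | just (ruleA _)   = refl
  ...   | just (ruleB _ _) = refl
  ...   | just (ruleC _)   = refl
  ...   | nothing          = refl
  br-suc n (mone ∷ v) | false with endsMone (mone ∷ v)
  ... | just _  = refl
  ... | nothing with findStep (mone ∷ v)
  ...   | just (ruleA _)   = refl
  ...   | just (ruleB _ _) = refl
  ...   | just (ruleC _)   = refl
  ...   | nothing          = refl

  evalRule-cong : ∀ {f g} r → All (λ p → f p ≡ g p) (ruleWords r) → evalRule f r ≡ evalRule g r
  evalRule-cong halt                 []            = refl
  evalRule-cong (dropLeadingOne v)   (e ∷ [])      = cong (ie *_) e
  evalRule-cong (dropTrailingMone v) (e ∷ [])      = cong (id *_) e
  evalRule-cong (apply (ruleA w))    (e ∷ [])      = cong (ia *_) e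
  evalRule-cong (apply (ruleB w w′)) (e ∷ e′ ∷ []) = cong (ib *_) (cong₂ _+_ e e′)
  evalRule-cong (apply (ruleC w))    (e ∷ [])      = cong (ic *_) e

  -- Each rule deletes exactly one letter, so the fuel left by ⟦ x ∷ v ⟧ is exactly
  -- the length of every word it recurses on; no fuel-irrelevance lemma is needed.
  ⟦⟧-unfold : ∀ u → ⟦ u ⟧ ≡ evalRule ⟦_⟧ (rule u)
  ⟦⟧-unfold []      = refl
  ⟦⟧-unfold (x ∷ v) = trans (br-suc (length v) (x ∷ v))
    (evalRule-cong (rule (x ∷ v)) (All.map fuel (rule-deletes (x ∷ v))))
    where
    fuel : ∀ {p} → p ≺ x ∷ v → br (length v) p ≡ ⟦ p ⟧
    fuel d = cong (λ n → br n _) (sym (suc-injective (≺-length d)))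

  module _ {x} (x≢one : ¬ x ≡ one) (z : Word) where

    ⟦⟧-trailing : ∀ {v} → endsMone (x ∷ z) ≡ just v → ⟦ x ∷ z ⟧ ≡ id * ⟦ v ⟧
    ⟦⟧-trailing e rewrite ⟦⟧-unfold (x ∷ z) | rule-∷ x≢one z
                        | ≺-allZero (endsMone-deletes (x ∷ z) e) | e = refl

    ⟦⟧-redex : ∀ {s} → endsMone (x ∷ z) ≡ nothing → findStep (x ∷ z) ≡ just s →
               ⟦ x ∷ z ⟧ ≡ evalStep ⟦_⟧ s
    ⟦⟧-redex e f rewrite ⟦⟧-unfold (x ∷ z) | rule-∷ x≢one z
                       | findStep-nonzero (x ∷ z) f | e | f = refl

    ⟦⟧-halt : endsMone (x ∷ z) ≡ nothing → findStep (x ∷ z) ≡ nothing → ⟦ x ∷ z ⟧ ≡ 1#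
    ⟦⟧-halt e f rewrite ⟦⟧-unfold (x ∷ z) | rule-∷ x≢one z | e | f =
      cong (evalRule ⟦_⟧) (if-eta (allZero (x ∷ z)))

  evalStep-mapStep : ∀ h f s → evalStep h (mapStep f s) ≡ evalStep (h ∘ f) s
  evalStep-mapStep h f (ruleA _)   = refl
  evalStep-mapStep h f (ruleB _ _) = refl
  evalStep-mapStep h f (ruleC _)   = refl

  evalStep-*ʳ : ∀ {h k} c s → All (λ p → h p ≈ k p * c) (stepWords s) →
                evalStep h s ≈ evalStep k s * c
  evalStep-*ʳ {h} {k} c (ruleA w) (e ∷ []) = begin
    ia * h w         ≈⟨ *-congˡ e ⟩
    ia * (k w * c)   ≈⟨ *-assoc ia (k w) c ⟨
    ia * k w * c     ∎
  evalStep-*ʳ {h} {k} c (ruleB w w′) (e ∷ e′ ∷ []) = begin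
    ib * (h w + h w′)           ≈⟨ *-congˡ (+-cong e e′) ⟩
    ib * (k w * c + k w′ * c)   ≈⟨ *-congˡ (distribʳ c (k w) (k w′)) ⟨
    ib * ((k w + k w′) * c)     ≈⟨ *-assoc ib (k w + k w′) c ⟨
    ib * (k w + k w′) * c       ∎
  evalStep-*ʳ {h} {k} c (ruleC w) (e ∷ []) = begin
    ic * h w         ≈⟨ *-congˡ e ⟩
    ic * (k w * c)   ≈⟨ *-assoc ic (k w) c ⟨
    ic * k w * c     ∎

  Splits : Word → Word → Set ℓ
  Splits u w = ⟦ u ++ nil ∷ w ⟧ ≈ ⟦ u ++ nil ∷ [] ⟧ * ⟦ nil ∷ w ⟧

  module _ {x} (x≢one : ¬ x ≡ one) (u w : Word)
           (ih : ∀ u′ w′ → u′ ++ nil ∷ w′ ≺ (x ∷ u) ++ nil ∷ w → Splits u′ w′) where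

    private
      U = x ∷ u

      endsMone-after : ∀ a {m} → endsMone w ≡ m →
                       endsMone (a ++ nil ∷ w) ≡ Maybe.map (λ v → a ++ nil ∷ v) m
      endsMone-after a e = trans (endsMone-++-nil∷ a w) (cong (Maybe.map _) e)

    split-trailing : ∀ {v} → endsMone w ≡ just v → Splits U w
    split-trailing {v} e = begin
      ⟦ U ++ nil ∷ w ⟧
        ≡⟨ ⟦⟧-trailing x≢one (u ++ nil ∷ w) (endsMone-after U e) ⟩
      id * ⟦ U ++ nil ∷ v ⟧
        ≈⟨ *-congˡ (ih U v (≺-++ˡ U (keep nil (endsMone-deletes w e)))) ⟩
      id * (⟦ U ++ nil ∷ [] ⟧ * ⟦ nil ∷ v ⟧)
        ≈⟨ x∙yz≈y∙xz id _ _ ⟩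
      ⟦ U ++ nil ∷ [] ⟧ * (id * ⟦ nil ∷ v ⟧)
        ≡⟨ cong (⟦ U ++ nil ∷ [] ⟧ *_) (⟦⟧-trailing nil≢one w (endsMone-after [] e)) ⟨
      ⟦ U ++ nil ∷ [] ⟧ * ⟦ nil ∷ w ⟧
        ∎

    split-leftRedex : ∀ {s} → endsMone w ≡ nothing → leftRedex U ≡ just s → Splits U w
    split-leftRedex {s} e l = begin
      ⟦ U ++ nil ∷ w ⟧
        ≡⟨ ⟦⟧-redex x≢one (u ++ nil ∷ w) (endsMone-after U e) f ⟩
      evalStep ⟦_⟧ (mapStep (_++ nil ∷ w) s)
        ≡⟨ evalStep-mapStep ⟦_⟧ (_++ nil ∷ w) s ⟩
      evalStep (λ p → ⟦ p ++ nil ∷ w ⟧) s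
        ≈⟨ evalStep-*ʳ ⟦ nil ∷ w ⟧ s (All.map (λ {p} → ih p w) deletes) ⟩
      evalStep (λ p → ⟦ p ++ nil ∷ [] ⟧) s * ⟦ nil ∷ w ⟧
        ≡⟨ cong (_* ⟦ nil ∷ w ⟧) (trans left₀ (evalStep-mapStep ⟦_⟧ (_++ nil ∷ []) s)) ⟨
      ⟦ U ++ nil ∷ [] ⟧ * ⟦ nil ∷ w ⟧
        ∎
      where
      f = findStep-++-leftRedex U w l
      deletes = mapStep-deletes (_++ nil ∷ w) s (findStep-deletes′ _ f)
      left₀ = ⟦⟧-redex x≢one (u ++ nil ∷ []) (endsMone-++-nil∷ U []) (findStep-++-leftRedex U [] l)

    split-rightRedex : ∀ {s} → endsMone w ≡ nothing → leftRedex U ≡ nothing →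
                       findStep (nil ∷ w) ≡ just s → Splits U w
    split-rightRedex {s} e l f = begin
      ⟦ U ++ nil ∷ w ⟧
        ≡⟨ ⟦⟧-redex x≢one (u ++ nil ∷ w) (endsMone-after U e) (findStep-++-noLeftRedex U w l f) ⟩
      evalStep ⟦_⟧ (mapStep (U ++_) s)
        ≡⟨ evalStep-mapStep ⟦_⟧ (U ++_) s ⟩
      evalStep (λ q → ⟦ U ++ q ⟧) s
        ≈⟨ evalStep-*ʳ ⟦ U ++ nil ∷ [] ⟧ s (All.map viaIH (findStep-deletes′ (nil ∷ w) f)) ⟩
      evalStep ⟦_⟧ s * ⟦ U ++ nil ∷ [] ⟧
        ≈⟨ *-comm _ _ ⟩
      ⟦ U ++ nil ∷ [] ⟧ * evalStep ⟦_⟧ s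
        ≡⟨ cong (⟦ U ++ nil ∷ [] ⟧ *_) (⟦⟧-redex nil≢one w (endsMone-after [] e) f) ⟨
      ⟦ U ++ nil ∷ [] ⟧ * ⟦ nil ∷ w ⟧
        ∎
      where
      -- No rule deletes the 0 in front of w.
      viaIH : ∀ {q} → q ≺ nil ∷ w → ⟦ U ++ q ⟧ ≈ ⟦ q ⟧ * ⟦ U ++ nil ∷ [] ⟧
      viaIH (keep nil d) = ≈-trans (ih U _ (≺-++ˡ U (keep nil d))) (*-comm _ _)

    split-halt : endsMone w ≡ nothing → leftRedex U ≡ nothing →
                 findStep (nil ∷ w) ≡ nothing → Splits U w
    split-halt e l f = begin
      ⟦ U ++ nil ∷ w ⟧
        ≡⟨ ⟦⟧-halt x≢one (u ++ nil ∷ w) (endsMone-after U e) (findStep-++-noLeftRedex U w l f) ⟩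
      1#
        ≈⟨ *-identityˡ 1# ⟨
      1# * 1#
        ≡⟨ cong₂ _*_ halt₀ (⟦⟧-halt nil≢one w (endsMone-after [] e) f) ⟨
      ⟦ U ++ nil ∷ [] ⟧ * ⟦ nil ∷ w ⟧
        ∎
      where
      halt₀ = ⟦⟧-halt x≢one (u ++ nil ∷ []) (endsMone-++-nil∷ U []) (findStep-++-noLeftRedex U [] l refl)

    split-inner : Splits U w
    split-inner with endsMone w in e
    ... | just v  = split-trailing e
    ... | nothing with leftRedex U in l
    ...   | just s  = split-leftRedex e l
    ...   | nothing with findStep (nil ∷ w) in f
    ...     | just s  = split-rightRedex e l f
    ...     | nothing = split-halt e l f

  split-step : ∀ u w → (∀ u′ w′ → u′ ++ nil ∷ w′ ≺ u ++ nil ∷ w → Splits u′ w′) →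
               Splits u w
  split-step []         w ih = ≈-sym (*-identityˡ _)
  split-step (one ∷ u)  w ih = ≈-trans (*-congˡ (ih u w drop-one)) (≈-sym (*-assoc ie _ _))
  split-step (nil ∷ u)  w ih = split-inner nil≢one u w ih
  split-step (mone ∷ u) w ih = split-inner (λ ()) u w ih

  split-length : ∀ n u w → length (u ++ nil ∷ w) ≡ n → Splits u w
  split-length zero    []      w ()
  split-length zero    (_ ∷ _) w ()
  split-length (suc n) u       w eq =
    split-step u w (λ u′ w′ d → split-length n u′ w′ (suc-injective (trans (≺-length d) eq)))

  split : ∀ u w → Splits u w
  split u w = split-length _ u w refl

  split-blocks : ∀ ms vᵣ →
    ⟦ nil ∷ concat (map (λ m → m ++ nil ∷ []) ms) ++ vᵣ ⟧
      ≈ product (map (λ m → ⟦ nil ∷ (m ++ nil ∷ []) ⟧) ms) * ⟦ nil ∷ vᵣ ⟧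
  split-blocks []       vᵣ = ≈-sym (*-identityˡ _)
  split-blocks (m ∷ ms) vᵣ = begin
    ⟦ nil ∷ ((m ++ nil ∷ []) ++ rest) ++ vᵣ ⟧
      ≡⟨ cong (λ t → ⟦ nil ∷ t ⟧) reassociate ⟩
    ⟦ (nil ∷ m) ++ nil ∷ rest ++ vᵣ ⟧
      ≈⟨ split (nil ∷ m) (rest ++ vᵣ) ⟩
    ⟦ nil ∷ (m ++ nil ∷ []) ⟧ * ⟦ nil ∷ rest ++ vᵣ ⟧
      ≈⟨ *-congˡ (split-blocks ms vᵣ) ⟩
    ⟦ nil ∷ (m ++ nil ∷ []) ⟧ * (product (map (λ m → ⟦ nil ∷ (m ++ nil ∷ []) ⟧) ms) * ⟦ nil ∷ vᵣ ⟧)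
      ≈⟨ *-assoc _ _ _ ⟨
    product (map (λ m → ⟦ nil ∷ (m ++ nil ∷ []) ⟧) (m ∷ ms)) * ⟦ nil ∷ vᵣ ⟧
      ∎
    where
    rest = concat (map (λ m → m ++ nil ∷ []) ms)
    reassociate : ((m ++ nil ∷ []) ++ rest) ++ vᵣ ≡ m ++ nil ∷ rest ++ vᵣ
    reassociate = trans (++-assoc (m ++ nil ∷ []) rest vᵣ) (++-assoc m (nil ∷ []) (rest ++ vᵣ))

proposition4 : ∀ {c ℓ} (R : CommutativeRing c ℓ)
                 (ia ib ic id ie : CommutativeRing.Carrier R)
                 (v₁ : Word) (ms : List Word) (vᵣ : Word) →
                 let open CommutativeRing R
                     open Bracket R ia ib ic id ie
                 in ⟦ joinWords v₁ ms vᵣ ⟧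
                    ≈ (⟦ v₁ ++ (nil ∷ []) ⟧
                       * product (map (λ m → ⟦ nil ∷ (m ++ (nil ∷ [])) ⟧) ms))
                       * ⟦ nil ∷ vᵣ ⟧
proposition4 R ia ib ic id ie v₁ ms vᵣ = begin
  ⟦ v₁ ++ nil ∷ blocks ⟧                                    ≈⟨ split v₁ blocks ⟩
  ⟦ v₁ ++ nil ∷ [] ⟧ * ⟦ nil ∷ blocks ⟧                     ≈⟨ *-congˡ (split-blocks ms vᵣ) ⟩
  ⟦ v₁ ++ nil ∷ [] ⟧ * (product brackets * ⟦ nil ∷ vᵣ ⟧)   ≈⟨ *-assoc _ _ _ ⟨
  ⟦ v₁ ++ nil ∷ [] ⟧ * product brackets * ⟦ nil ∷ vᵣ ⟧      ∎
  where
  open CommutativeRing R using (setoid; _*_; *-congˡ; *-assoc)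
  open Bracket R ia ib ic id ie
  open Evaluation R ia ib ic id ie using (split; split-blocks)
  open SetoidReasoning setoid
  blocks = concat (map (λ m → m ++ nil ∷ []) ms) ++ vᵣ
  brackets = map (λ m → ⟦ nil ∷ (m ++ nil ∷ []) ⟧) ms
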